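{- Let $G=(V,W,E)$ be a bipartite graph. Then there is $I \subseteq W$ with $|I| \leq |W| - \mathrm{rk}(A_G)$ such that $R^{I}(G)$ is rigid.
   Context: Multipede construction $R(G)$: for each $w\in W$ vertices $a(w),b(w)$, $F(w)=\{a(w),b(w)\}$; for each $v\in V$ and $A\subseteq N(v)$ with $|A|$ even a vertex $m_A(v)$, $M(v)$ the set of these; edges $\{a(w),m_A(v)\}$ for $w\in A$ and $\{b(w),m_A(v)\}$ for $w\in N(v)\setminus A$. $R(G)$ is colored with color classes exactly the $F(w)$ ($w\in W$) and $M(v)$ ($v\in V$). For $I\subseteq W$, $R^I(G)$ is $R(G)$ with the coloring refined so that $\{a(w)\}$, $\{b(w)\}$ are color classes for all $w\in I$. Rigid means the only color-preserving automorphism is the identity. $A_G\in\mathbb{F}_2^{V\times W}$ has $(A_G)_{v,w}=1$ iff $\{v,w\}\in E$; $\mathrm{rk}$ is rank over $\mathbb{F}_2$. -}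

module Defs where

open import Data.Bool using (Bool; true; false; _∧_; _xor_; not; if_then_else_; T)
open import Data.Nat using (ℕ; zero; suc; _≤_)
open import Data.Fin using (Fin)
open import Data.Fin.Subset using (Subset; ∣_∣; _⊆_; Empty)
open import Data.Vec using (Vec; lookup; tabulate; foldr; zipWith)
open import Data.Product using (Σ; _×_; ∃)
open import Relation.Binary.PropositionalEquality using (_≡_)
open import Function.Bundles using (_↔_; Inverse)

-- A finite bipartite graph G = (V, W, E) with V = Fin n, W = Fin m is given by
-- its biadjacency matrix  E : Fin n → Fin m → Bool  (E v w = true iff {v,w} ∈ E),
-- which is exactly A_G over F₂ (true = 1).
BiAdj : ℕ → ℕ → Set
BiAdj n m = Fin n → Fin m → Bool

evenᵇ : ℕ → Bool
evenᵇ zero = true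
evenᵇ (suc k) = not (evenᵇ k)

allᵇ : ∀ {k} → Vec Bool k → Bool
allᵇ = foldr _ _∧_ true

module _ {n m : ℕ} (E : BiAdj n m) where

  N : Fin n → Subset m
  N v = tabulate (E v)

  -- A ⊆ N(v) and |A| even (Boolean, so that the proof is unique)
  validᵇ : Fin n → Subset m → Bool
  validᵇ v A = allᵇ (zipWith (λ x y → if x then y else true) A (N v)) ∧ evenᵇ ∣ A ∣

  data Vtx : Set where
    a : Fin m → Vtx
    b : Fin m → Vtx
    mv : (v : Fin n) (A : Subset m) → T (validᵇ v A) → Vtx

  adj : Vtx → Vtx → Bool
  adj (a w) (mv v A _) = lookup A w
  adj (b w) (mv v A _) = E v w ∧ not (lookup A w)
  adj (mv v A _) (a w) = lookup A w
  adj (mv v A _) (b w) = E v w ∧ not (lookup A w)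
  adj _ _ = false

  -- colours of R^I(G): F(w) for w ∉ I, {a(w)},{b(w)} for w ∈ I, M(v)
  data Colour : Set where
    cF cA cB : Fin m → Colour
    cM : Fin n → Colour

  colour : Subset m → Vtx → Colour
  colour I (a w) = if lookup I w then cA w else cF w
  colour I (b w) = if lookup I w then cB w else cF w
  colour I (mv v _ _) = cM v

  IsColAut : Subset m → Vtx ↔ Vtx → Set
  IsColAut I σ = (∀ x y → adj (Inverse.to σ x) (Inverse.to σ y) ≡ adj x y)
               × (∀ x → colour I (Inverse.to σ x) ≡ colour I x)

  Rigid : Subset m → Set
  Rigid I = ∀ (σ : Vtx ↔ Vtx) → IsColAut I σ → ∀ x → Inverse.to σ x ≡ x

  rowSum : Subset n → Fin m → Bool
  rowSum S w = foldr _ _xor_ false (zipWith _∧_ S (tabulate (λ v → E v w)))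

  RowsIndep : Subset n → Set
  RowsIndep S = ∀ T → T ⊆ S → (∀ w → rowSum T w ≡ false) → Empty T

  HasRank : ℕ → Set
  HasRank r = (∃ λ S → RowsIndep S × ∣ S ∣ ≡ r) × (∀ S → RowsIndep S → ∣ S ∣ ≤ r)

module Submission where

-- Let σ be a colour-preserving automorphism of R^I(G).  It maps every class F(w) = {a(w),
-- b(w)} onto itself, and it swaps a(w), b(w) only for w ∉ I; let x ∈ 𝔽₂^W be the vector of
-- swapped pairs.  Since σ(m_∅(v)) = m_{N(v)∩x}(v) and the index set of an M-vertex is even,
-- A_G x = 0; and if x = 0 then σ is the identity, because m_A(v) is determined by its
-- neighbours a(w).  Hence R^I(G) is rigid as soon as the only x supported outside I with
-- A_G x = 0 is x = 0 (rigid-criterion).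
--
-- It remains to find I of size at most |W| - rk(A_G) with this property, that is a set
-- J = W ∖ I of at least rk(A_G) columns which are linearly independent.  This is "row rank
-- ≤ column rank" over 𝔽₂ (rowRank≤colRank), proved by Gaussian elimination column by
-- column: given independent rows S, column 0 either vanishes on S and is discarded, or has
-- a pivot v₀ ∈ S, is eliminated, and joins J while v₀ leaves S.

open import Defs
open import Algebra.Bundles using (CommutativeRing)
open import Data.Bool using (Bool; true; false; _∧_; _xor_; not; T; if_then_else_)
open import Data.Bool.Properties
  using (xor-∧-commutativeRing; ∧-assoc; ∧-zeroʳ; ∧-identityʳ; ∧-distribʳ-xor;
         xor-identityʳ; xor-same; ¬-not; not-involutive; T-≡; T-∧; T-irrelevant)
import Data.Bool.Properties as Bool
open import Data.Fin using (Fin; zero; suc; punchIn; _≟_)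
open import Data.Fin.Properties using (punchInᵢ≢i; any?)
open import Data.Fin.Subset using (Subset; ∣_∣; _∈_; _∉_; _-_; ∁; ⊥; outside; inside)
open import Data.Fin.Subset.Properties
  using (_∈?_; ∣⊥∣≡0; ∣∁p∣≡n∸∣p∣; Empty-unique; x∉∁p⇒x∈p; drop-there; p─q⊆p; p─⊥≡p)
open import Data.Nat using (ℕ; zero; suc; _≤_; _∸_; s≤s)
open import Data.Nat.Properties using (≤-trans; ≤-reflexive; n≤1+n; ∸-monoʳ-≤)
open import Data.Product using (∃; _×_; _,_; proj₁; proj₂)
open import Data.Sum using (_⊎_; inj₁; inj₂)
open import Data.Vec using (Vec; []; _∷_; lookup; there; tabulate; foldr; zipWith)
open import Data.Vec.Functional using (Vector)
open import Data.Vec.Properties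
  using (lookup⇒[]=; []=⇒lookup; lookup∘tabulate; tabulate∘lookup; tabulate-cong; lookup-replicate)
open import Function using (case_of_)
open import Function.Bundles using (_↔_; Inverse; Equivalence; Injection)
open import Function.Properties.Inverse using (↔⇒↣)
open import Relation.Binary.PropositionalEquality
  using (_≡_; _≢_; refl; sym; trans; cong; cong₂; subst; module ≡-Reasoning)
open import Relation.Nullary using (yes; no; ¬_)
open import Relation.Nullary.Decidable using (does; dec-true; dec-false; _×-dec_)
open import Algebra.Properties.Semiring.Sum (CommutativeRing.semiring xor-∧-commutativeRing)
  using (sum; ∑-distrib-+; *-distribˡ-sum; *-distribʳ-sum; sum-cong-≗; sum-replicate-zero; sum-remove)

open ≡-Reasoning

-- Vectors over 𝔽₂ are Boolean vectors Fin k → Bool with xor as addition and ∧ as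
-- multiplication; sum is the finite sum in the standard library's Boolean ring.

Null : ∀ {k} → Vector Bool k → Set
Null x = ∀ i → x i ≡ false

_⊑_ : ∀ {k} → Vector Bool k → Subset k → Set
x ⊑ S = ∀ i → x i ≡ true → i ∈ S

sum-null : ∀ {k} (f : Vector Bool k) → Null f → sum f ≡ false
sum-null {k} f f≡0 = trans (sum-cong-≗ f≡0) (sum-replicate-zero k)

vanishing-term : ∀ {z} s y → z ≡ false → (s ∧ z) xor y ≡ y
vanishing-term s y refl = cong (_xor y) (∧-zeroʳ s)

xor≡0⇒≡ : ∀ r s → r xor s ≡ false → s ≡ r
xor≡0⇒≡ false s h = h
xor≡0⇒≡ true  s h = trans (sym (not-involutive s)) (cong not h)

e : ∀ {k} → Fin k → Vector Bool k
e j i = does (i ≟ j)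

sum-e : ∀ {k} (j : Fin k) (g : Vector Bool k) → sum (λ i → e j i ∧ g i) ≡ g j
sum-e {suc k} j g = begin
  sum (λ i → e j i ∧ g i)
    ≡⟨ sum-remove {i = j} (λ i → e j i ∧ g i) ⟩
  (e j j ∧ g j) xor sum (λ l → e j (punchIn j l) ∧ g (punchIn j l))
    ≡⟨ cong₂ _xor_ e-jj (sum-null _ e-off) ⟩
  g j xor false
    ≡⟨ xor-identityʳ (g j) ⟩
  g j ∎
  where
    e-jj : e j j ∧ g j ≡ g j
    e-jj = cong (_∧ g j) (dec-true (j ≟ j) refl)
    e-off : ∀ l → e j (punchIn j l) ∧ g (punchIn j l) ≡ false
    e-off l = cong (_∧ g (punchIn j l)) (dec-false (punchIn j l ≟ j) (punchInᵢ≢i j l))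

x∉p-x : ∀ {k} (p : Subset k) x → x ∉ p - x
x∉p-x (s ∷ p) zero    ()
x∉p-x (s ∷ p) (suc x) (there x∈p-x) = x∉p-x p x x∈p-x

∣p∣≤1+∣p-x∣ : ∀ {k} (p : Subset k) x → ∣ p ∣ ≤ suc ∣ p - x ∣
∣p∣≤1+∣p-x∣ (inside  ∷ p) zero    = s≤s (≤-reflexive (cong ∣_∣ (sym (p─⊥≡p p))))
∣p∣≤1+∣p-x∣ (outside ∷ p) zero    = ≤-trans (≤-reflexive (cong ∣_∣ (sym (p─⊥≡p p)))) (n≤1+n _)
∣p∣≤1+∣p-x∣ (inside  ∷ p) (suc x) = s≤s (∣p∣≤1+∣p-x∣ p x)
∣p∣≤1+∣p-x∣ (outside ∷ p) (suc x) = ∣p∣≤1+∣p-x∣ p x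

lookup-ext : ∀ {k} {A : Set} {xs ys : Vec A k} → (∀ i → lookup xs i ≡ lookup ys i) → xs ≡ ys
lookup-ext {xs = xs} {ys} eq =
  trans (sym (tabulate∘lookup xs)) (trans (tabulate-cong eq) (tabulate∘lookup ys))

∈-tabulate⁺ : ∀ {k} {c : Vector Bool k} {i} → c i ≡ true → i ∈ tabulate c
∈-tabulate⁺ {c = c} {i} ci = lookup⇒[]= i (tabulate c) (trans (lookup∘tabulate c i) ci)

∈-tabulate⁻ : ∀ {k} {c : Vector Bool k} {i} → i ∈ tabulate c → c i ≡ true
∈-tabulate⁻ {c = c} {i} i∈c = trans (sym (lookup∘tabulate c i)) ([]=⇒lookup i∈c)

even-size : ∀ {k} (p : Subset k) → evenᵇ ∣ p ∣ ≡ not (sum (lookup p))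
even-size []            = refl
even-size (inside  ∷ p) = cong not (even-size p)
even-size (outside ∷ p) = even-size p

Matrix : ℕ → ℕ → Set
Matrix n m = Fin n → Fin m → Bool

rowComb : ∀ {n m} → Matrix n m → Vector Bool n → Vector Bool m
rowComb ρ c w = sum (λ v → c v ∧ ρ v w)

colComb : ∀ {n m} → Matrix n m → Vector Bool m → Vector Bool n
colComb ρ x v = sum (λ w → ρ v w ∧ x w)

RowIndep : ∀ {n m} → Matrix n m → Subset n → Set
RowIndep ρ S = ∀ c → c ⊑ S → Null (rowComb ρ c) → Null c

ColIndep : ∀ {n m} → Matrix n m → Subset n → Subset m → Set
ColIndep ρ S J = ∀ x → x ⊑ J → (∀ v → v ∈ S → colComb ρ x v ≡ false) → Null x

dropCol : ∀ {n m} → Matrix n (suc m) → Matrix n m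
dropCol ρ v w = ρ v (suc w)

dropCol-rowIndep : ∀ {n m} {ρ : Matrix n (suc m)} {S} →
  (∀ v → v ∈ S → ρ v zero ≡ false) → RowIndep ρ S → RowIndep (dropCol ρ) S
dropCol-rowIndep {ρ = ρ} col0 ind c c⊑S c≡0 = ind c c⊑S λ
  { zero    → sum-null _ term≡0
  ; (suc w) → c≡0 w }
  where
    term≡0 : ∀ v → c v ∧ ρ v zero ≡ false
    term≡0 v with c v in cv
    ... | false = refl
    ... | true  = col0 v (c⊑S v cv)

dropCol-colIndep : ∀ {n m} {ρ : Matrix n (suc m)} {S J} →
  ColIndep (dropCol ρ) S J → ColIndep ρ S (outside ∷ J)
dropCol-colIndep {ρ = ρ} {S} ind x x⊑J ρx≡0 = λ
  { zero    → x₀≡0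
  ; (suc w) → ind (λ w → x (suc w)) (λ w xw → drop-there (x⊑J (suc w) xw)) tail≡0 w }
  where
    x₀≡0 : x zero ≡ false
    x₀≡0 = ¬-not λ x₀ → case x⊑J zero x₀ of λ ()
    tail≡0 : ∀ v → v ∈ S → colComb (dropCol ρ) (λ w → x (suc w)) v ≡ false
    tail≡0 v v∈S = trans (sym (vanishing-term (ρ v zero) _ x₀≡0)) (ρx≡0 v v∈S)

-- One step of Gaussian elimination with pivot ρ v₀ 0 = 1: add ρ v 0 times row v₀ to
-- every row v, which clears column 0 outside v₀, and then delete column 0.
eliminate : ∀ {n m} → Matrix n (suc m) → Fin n → Matrix n m
eliminate ρ v₀ v w = ρ v (suc w) xor (ρ v zero ∧ ρ v₀ (suc w))

rowComb-eliminate : ∀ {n m} (ρ : Matrix n (suc m)) v₀ c w →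
  rowComb (eliminate ρ v₀) c w ≡ rowComb ρ c (suc w) xor (rowComb ρ c zero ∧ ρ v₀ (suc w))
rowComb-eliminate ρ v₀ c w = begin
  sum (λ v → c v ∧ (ρ v (suc w) xor (ρ v zero ∧ k)))
    ≡⟨ sum-cong-≗ (λ v → distrib (c v) (ρ v (suc w)) (ρ v zero)) ⟩
  sum (λ v → (c v ∧ ρ v (suc w)) xor ((c v ∧ ρ v zero) ∧ k))
    ≡⟨ ∑-distrib-+ (λ v → c v ∧ ρ v (suc w)) (λ v → (c v ∧ ρ v zero) ∧ k) ⟩
  rowComb ρ c (suc w) xor sum (λ v → (c v ∧ ρ v zero) ∧ k)
    ≡⟨ cong (rowComb ρ c (suc w) xor_) (sym (*-distribʳ-sum k (λ v → c v ∧ ρ v zero))) ⟩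
  rowComb ρ c (suc w) xor (rowComb ρ c zero ∧ k) ∎
  where
    k : Bool
    k = ρ v₀ (suc w)
    distrib : ∀ c r s → c ∧ (r xor (s ∧ k)) ≡ (c ∧ r) xor ((c ∧ s) ∧ k)
    distrib false r s = refl
    distrib true  r s = refl

colComb-eliminate : ∀ {n m} (ρ : Matrix n (suc m)) v₀ x v →
  colComb (eliminate ρ v₀) x v ≡ colComb (dropCol ρ) x v xor (ρ v zero ∧ colComb (dropCol ρ) x v₀)
colComb-eliminate ρ v₀ x v = begin
  sum (λ w → (ρ v (suc w) xor (s ∧ ρ v₀ (suc w))) ∧ x w)
    ≡⟨ sum-cong-≗ (λ w → distrib (ρ v (suc w)) (ρ v₀ (suc w)) (x w)) ⟩
  sum (λ w → (ρ v (suc w) ∧ x w) xor (s ∧ (ρ v₀ (suc w) ∧ x w)))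
    ≡⟨ ∑-distrib-+ (λ w → ρ v (suc w) ∧ x w) (λ w → s ∧ (ρ v₀ (suc w) ∧ x w)) ⟩
  colComb (dropCol ρ) x v xor sum (λ w → s ∧ (ρ v₀ (suc w) ∧ x w))
    ≡⟨ cong (colComb (dropCol ρ) x v xor_) (sym (*-distribˡ-sum s (λ w → ρ v₀ (suc w) ∧ x w))) ⟩
  colComb (dropCol ρ) x v xor (s ∧ colComb (dropCol ρ) x v₀) ∎
  where
    s : Bool
    s = ρ v zero
    distrib : ∀ r k y → (r xor (s ∧ k)) ∧ y ≡ (r ∧ y) xor (s ∧ (k ∧ y))
    distrib r k y = trans (∧-distribʳ-xor y r (s ∧ k)) (cong ((r ∧ y) xor_) (∧-assoc s k y))

rowComb-basis : ∀ {n m} (ρ : Matrix n m) c j t w →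
  rowComb ρ (λ u → c u xor (e j u ∧ t)) w ≡ rowComb ρ c w xor (t ∧ ρ j w)
rowComb-basis ρ c j t w = begin
  sum (λ u → (c u xor (e j u ∧ t)) ∧ ρ u w)
    ≡⟨ sum-cong-≗ (λ u → distrib (c u) (e j u) (ρ u w)) ⟩
  sum (λ u → (c u ∧ ρ u w) xor (e j u ∧ (t ∧ ρ u w)))
    ≡⟨ ∑-distrib-+ (λ u → c u ∧ ρ u w) (λ u → e j u ∧ (t ∧ ρ u w)) ⟩
  rowComb ρ c w xor sum (λ u → e j u ∧ (t ∧ ρ u w))
    ≡⟨ cong (rowComb ρ c w xor_) (sum-e j (λ u → t ∧ ρ u w)) ⟩
  rowComb ρ c w xor (t ∧ ρ j w) ∎
  where
    distrib : ∀ c' d r → (c' xor (d ∧ t)) ∧ r ≡ (c' ∧ r) xor (d ∧ (t ∧ r))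
    distrib c' d r = trans (∧-distribʳ-xor r c' (d ∧ t)) (cong ((c' ∧ r) xor_) (∧-assoc d t r))

-- Elimination keeps the rows of S other than the pivot row independent: a dependency c
-- among them lifts to the dependency c + (cᵀρ)₀ · e v₀ among the rows of S in ρ.
eliminate-rowIndep : ∀ {n m} {ρ : Matrix n (suc m)} {S v₀} →
  v₀ ∈ S → ρ v₀ zero ≡ true → RowIndep ρ S → RowIndep (eliminate ρ v₀) (S - v₀)
eliminate-rowIndep {n} {ρ = ρ} {S} {v₀} v₀∈S pivot ind c c⊑S' c≡0 = c-vanishes
  where
    t : Bool
    t = rowComb ρ c zero
    c* : Vector Bool n
    c* u = c u xor (e v₀ u ∧ t)
    c*-off : ∀ {u} → u ≢ v₀ → c* u ≡ c u
    c*-off {u} u≢v₀ =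
      trans (cong (λ z → c u xor (z ∧ t)) (dec-false (u ≟ v₀) u≢v₀)) (xor-identityʳ (c u))
    c*⊑S : c* ⊑ S
    c*⊑S u c*u = case u ≟ v₀ of λ
      { (yes refl)  → v₀∈S
      ; (no  u≢v₀) → p─q⊆p S _ (c⊑S' u (trans (sym (c*-off u≢v₀)) c*u)) }
    c*-dependency : Null (rowComb ρ c*)
    c*-dependency zero    = begin
      rowComb ρ c* zero      ≡⟨ rowComb-basis ρ c v₀ t zero ⟩
      t xor (t ∧ ρ v₀ zero)  ≡⟨ cong (λ z → t xor (t ∧ z)) pivot ⟩
      t xor (t ∧ true)       ≡⟨ cong (t xor_) (∧-identityʳ t) ⟩
      t xor t                ≡⟨ xor-same t ⟩
      false                  ∎
    c*-dependency (suc w) = begin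
      rowComb ρ c* (suc w)                         ≡⟨ rowComb-basis ρ c v₀ t (suc w) ⟩
      rowComb ρ c (suc w) xor (t ∧ ρ v₀ (suc w))  ≡⟨ sym (rowComb-eliminate ρ v₀ c w) ⟩
      rowComb (eliminate ρ v₀) c w                 ≡⟨ c≡0 w ⟩
      false                                        ∎
    c-vanishes : Null c
    c-vanishes u with u ≟ v₀
    ... | yes refl  = ¬-not λ cv₀ → x∉p-x S v₀ (c⊑S' v₀ cv₀)
    ... | no  u≢v₀ = trans (sym (c*-off u≢v₀)) (ind c* c*⊑S c*-dependency u)

-- Conversely, columns independent on S - v₀ after elimination, together with the pivot
-- column 0, are independent on S: the pivot row forces x₀ = 0, and the rest follows.
eliminate-colIndep : ∀ {n m} {ρ : Matrix n (suc m)} {S v₀ J} →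
  v₀ ∈ S → ρ v₀ zero ≡ true → ColIndep (eliminate ρ v₀) (S - v₀) J → ColIndep ρ S (inside ∷ J)
eliminate-colIndep {m = m} {ρ = ρ} {S} {v₀} v₀∈S pivot ind x x⊑J ρx≡0 = λ
  { zero    → x₀≡0
  ; (suc w) → xs≡0 w }
  where
    xs : Vector Bool m
    xs w = x (suc w)
    rest≡first : ∀ v → v ∈ S → colComb (dropCol ρ) xs v ≡ ρ v zero ∧ x zero
    rest≡first v v∈S = xor≡0⇒≡ (ρ v zero ∧ x zero) _ (ρx≡0 v v∈S)
    rest≡x₀ : colComb (dropCol ρ) xs v₀ ≡ x zero
    rest≡x₀ = trans (rest≡first v₀ v₀∈S) (cong (_∧ x zero) pivot)
    xs≡0 : Null xs
    xs≡0 = ind xs (λ w xw → drop-there (x⊑J (suc w) xw)) λ v v∈S-v₀ → begin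
      colComb (eliminate ρ v₀) xs v
        ≡⟨ colComb-eliminate ρ v₀ xs v ⟩
      colComb (dropCol ρ) xs v xor (ρ v zero ∧ colComb (dropCol ρ) xs v₀)
        ≡⟨ cong₂ (λ y z → y xor (ρ v zero ∧ z)) (rest≡first v (p─q⊆p S _ v∈S-v₀)) rest≡x₀ ⟩
      (ρ v zero ∧ x zero) xor (ρ v zero ∧ x zero)
        ≡⟨ xor-same (ρ v zero ∧ x zero) ⟩
      false ∎
    x₀≡0 : x zero ≡ false
    x₀≡0 = trans (sym rest≡x₀)
      (sum-null _ λ w → trans (cong (ρ v₀ (suc w) ∧_) (xs≡0 w)) (∧-zeroʳ _))

noColumns-rowIndep : ∀ {n} {ρ : Matrix n 0} {S} → RowIndep ρ S → ∣ S ∣ ≡ 0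
noColumns-rowIndep {n} {S = S} ind = trans (cong ∣_∣ (Empty-unique S-empty)) (∣⊥∣≡0 n)
  where
    S-empty : ¬ ∃ λ v → v ∈ S
    S-empty (v , v∈S) = case trans (sym ([]=⇒lookup v∈S))
                                   (ind (lookup S) (λ u Su → lookup⇒[]= u S Su) (λ ()) v) of λ ()

rowRank≤colRank : ∀ {n} m (ρ : Matrix n m) S → RowIndep ρ S →
  ∃ λ J → ∣ S ∣ ≤ ∣ J ∣ × ColIndep ρ S J
rowRank≤colRank zero ρ S ind = [] , ≤-reflexive (noColumns-rowIndep ind) , λ _ _ _ ()
rowRank≤colRank (suc m) ρ S ind
  with any? (λ v → (v ∈? S) ×-dec (ρ v zero Bool.≟ true))
... | yes (v₀ , v₀∈S , pivot) =
  let J , ∣S-v₀∣≤∣J∣ , J-indep = rowRank≤colRank m (eliminate ρ v₀) (S - v₀)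
                                   (eliminate-rowIndep v₀∈S pivot ind)
  in inside ∷ J , ≤-trans (∣p∣≤1+∣p-x∣ S v₀) (s≤s ∣S-v₀∣≤∣J∣)
                , eliminate-colIndep {ρ = ρ} v₀∈S pivot J-indep
... | no no-pivot =
  let J , ∣S∣≤∣J∣ , J-indep = rowRank≤colRank m (dropCol ρ) S (dropCol-rowIndep column₀≡0 ind)
  in outside ∷ J , ∣S∣≤∣J∣ , dropCol-colIndep {ρ = ρ} J-indep
  where
    column₀≡0 : ∀ v → v ∈ S → ρ v zero ≡ false
    column₀≡0 v v∈S = ¬-not λ ρv₀ → no-pivot (v , v∈S , ρv₀)

rowSum≡rowComb : ∀ {n m} (E : BiAdj n m) c w → rowSum E (tabulate c) w ≡ rowComb E c w
rowSum≡rowComb E c w = foldr-zipWith c (λ v → E v w)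
  where
    foldr-zipWith : ∀ {k} (c g : Vector Bool k) →
      foldr (λ _ → Bool) _xor_ false (zipWith _∧_ (tabulate c) (tabulate g)) ≡ sum (λ v → c v ∧ g v)
    foldr-zipWith {zero}  c g = refl
    foldr-zipWith {suc k} c g =
      cong ((c zero ∧ g zero) xor_) (foldr-zipWith (λ v → c (suc v)) (λ v → g (suc v)))

rowsIndep⇒RowIndep : ∀ {n m} (E : BiAdj n m) {S} → RowsIndep E S → RowIndep E S
rowsIndep⇒RowIndep E indep c c⊑S c≡0 v = ¬-not λ cv →
  indep (tabulate c) (λ i∈c → c⊑S _ (∈-tabulate⁻ i∈c))
        (λ w → trans (rowSum≡rowComb E c w) (c≡0 w)) (v , ∈-tabulate⁺ cv)

module _ {n m : ℕ} (E : BiAdj n m) where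

  ∅-valid : ∀ v → T (validᵇ E v ⊥)
  ∅-valid v = Equivalence.from T-≡ (cong₂ _∧_ (⊥-allowed (N E v)) (cong evenᵇ (∣⊥∣≡0 m)))
    where
      ⊥-allowed : ∀ {k} (ys : Vec Bool k) →
        allᵇ (zipWith (λ x y → if x then y else true) ⊥ ys) ≡ true
      ⊥-allowed []       = refl
      ⊥-allowed (y ∷ ys) = ⊥-allowed ys

  m∅ : Fin n → Vtx E
  m∅ v = mv v ⊥ (∅-valid v)

  adj-m∅ : ∀ s v w → adj E (if s then b w else a w) (m∅ v) ≡ E v w ∧ s
  adj-m∅ false v w = trans (lookup-replicate w false) (sym (∧-zeroʳ (E v w)))
  adj-m∅ true  v w = cong (λ z → E v w ∧ not z) (lookup-replicate w false)

  mv-≡ : ∀ {v A B} {p : T (validᵇ E v A)} {q : T (validᵇ E v B)} →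
    A ≡ B → _≡_ {A = Vtx E} (mv v A p) (mv v B q)
  mv-≡ {p = p} {q} refl = cong (mv _ _) (T-irrelevant p q)

  vertexPart : Vtx E → Fin m ⊎ Fin n
  vertexPart (a w)      = inj₁ w
  vertexPart (b w)      = inj₁ w
  vertexPart (mv v _ _) = inj₂ v

  colourPart : Colour E → Fin m ⊎ Fin n
  colourPart (cF w) = inj₁ w
  colourPart (cA w) = inj₁ w
  colourPart (cB w) = inj₁ w
  colourPart (cM v) = inj₂ v

  colour-refines : ∀ I y → colourPart (colour E I y) ≡ vertexPart y
  colour-refines I (a w) with lookup I w
  ... | true  = refl
  ... | false = refl
  colour-refines I (b w) with lookup I w
  ... | true  = refl
  ... | false = refl
  colour-refines I (mv v _ _) = refl

  samePart : ∀ I x y → colour E I x ≡ colour E I y → vertexPart x ≡ vertexPart y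
  samePart I x y eq =
    trans (sym (colour-refines I x)) (trans (cong colourPart eq) (colour-refines I y))

  inF : ∀ {w y} → vertexPart y ≡ inj₁ w → y ≡ a w ⊎ y ≡ b w
  inF {y = a w} refl = inj₁ refl
  inF {y = b w} refl = inj₂ refl

  inM : ∀ {v y} → vertexPart y ≡ inj₂ v → ∃ λ B → ∃ λ (q : T (validᵇ E v B)) → y ≡ mv v B q
  inM {y = mv v B q} refl = B , q , refl

  a≉b : ∀ {I w} → w ∈ I → colour E I (a w) ≢ colour E I (b w)
  a≉b {I} {w} w∈I rewrite []=⇒lookup w∈I = λ ()

module ColourPreserving {n m : ℕ} (E : BiAdj n m) (I : Subset m)
                        (σ : Vtx E ↔ Vtx E) (aut : IsColAut E I σ) where

  f : Vtx E → Vtx E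
  f = Inverse.to σ

  f-adj : ∀ x y → adj E (f x) (f y) ≡ adj E x y
  f-adj = proj₁ aut

  f-injective : ∀ {x y} → f x ≡ f y → x ≡ y
  f-injective = Injection.injective (↔⇒↣ σ)

  f-part : ∀ y → vertexPart E (f y) ≡ vertexPart E y
  f-part y = samePart E I (f y) y (proj₂ aut y)

  data PairAction (w : Fin m) : Set where
    fixes : f (a w) ≡ a w → f (b w) ≡ b w → PairAction w
    swaps : w ∉ I → f (a w) ≡ b w → f (b w) ≡ a w → PairAction w

  pairAction : ∀ w → PairAction w
  pairAction w with inF E (f-part (a w)) | inF E (f-part (b w))
  ... | inj₁ fa | inj₂ fb = fixes fa fb
  ... | inj₂ fa | inj₁ fb = swaps w∉I fa fb
    where
      w∉I : w ∉ I
      w∉I w∈I = a≉b E w∈I (sym (trans (cong (colour E I) (sym fa)) (proj₂ aut (a w))))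
  ... | inj₁ fa | inj₁ fb = case f-injective (trans fa (sym fb)) of λ ()
  ... | inj₂ fa | inj₂ fb = case f-injective (trans fa (sym fb)) of λ ()

  swapped : Fin m → Bool
  swapped w with pairAction w
  ... | fixes _ _   = false
  ... | swaps _ _ _ = true

  swapped-off-I : ∀ w → swapped w ≡ true → w ∉ I
  swapped-off-I w with pairAction w
  ... | swaps w∉I _ _ = λ _ → w∉I

  preimage-a : ∀ w → f (if swapped w then b w else a w) ≡ a w
  preimage-a w with pairAction w
  ... | fixes fa _    = fa
  ... | swaps _ _ fb  = fb

  -- σ(m_∅(v)) = m_B(v) with B = N(v) ∩ x; so x has an even number of entries in N(v),
  -- that is, A_G x = 0.
  swapped-kernel : ∀ v → colComb E swapped v ≡ false
  swapped-kernel v with inM E (f-part (m∅ E v))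
  ... | B , B-valid , σm∅≡mB = begin
    sum (λ w → E v w ∧ swapped w) ≡⟨ sum-cong-≗ (λ w → sym (B-entries w)) ⟩
    sum (lookup B)                ≡⟨ sym (not-involutive _) ⟩
    not (not (sum (lookup B)))    ≡⟨ cong not (trans (sym (even-size B)) B-even) ⟩
    false                         ∎
    where
      B-even : evenᵇ ∣ B ∣ ≡ true
      B-even = Equivalence.to T-≡ (proj₂ (Equivalence.to T-∧ B-valid))
      B-entries : ∀ w → lookup B w ≡ E v w ∧ swapped w
      B-entries w = begin
        adj E (a w) (mv v B B-valid)
          ≡⟨ cong (adj E (a w)) (sym σm∅≡mB) ⟩
        adj E (a w) (f (m∅ E v))
          ≡⟨ cong (λ y → adj E y (f (m∅ E v))) (sym (preimage-a w)) ⟩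
        adj E (f (if swapped w then b w else a w)) (f (m∅ E v))
          ≡⟨ f-adj _ (m∅ E v) ⟩
        adj E (if swapped w then b w else a w) (m∅ E v)
          ≡⟨ adj-m∅ E (swapped w) v w ⟩
        E v w ∧ swapped w ∎

  -- If no pair is swapped, σ is the identity: it fixes every a(w), b(w), and then every
  -- m_A(v), since A is recovered from the neighbours a(w) of m_A(v).
  unswapped⇒identity : Null swapped → ∀ y → f y ≡ y
  unswapped⇒identity none = fixed
    where
      fixed-pair : ∀ w → f (a w) ≡ a w × f (b w) ≡ b w
      fixed-pair w with pairAction w | none w
      ... | fixes fa fb | _ = fa , fb
      ... | swaps _ _ _ | ()
      fixed : ∀ y → f y ≡ y
      fixed (a w) = proj₁ (fixed-pair w)
      fixed (b w) = proj₂ (fixed-pair w)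
      fixed (mv v A p) with inM E (f-part (mv v A p))
      ... | B , q , σmA≡mB = trans σmA≡mB (mv-≡ E (lookup-ext B≡A))
        where
          B≡A : ∀ w → lookup B w ≡ lookup A w
          B≡A w = begin
            adj E (a w) (mv v B q)
              ≡⟨ cong (adj E (a w)) (sym σmA≡mB) ⟩
            adj E (a w) (f (mv v A p))
              ≡⟨ cong (λ y → adj E y (f (mv v A p))) (sym (proj₁ (fixed-pair w))) ⟩
            adj E (f (a w)) (f (mv v A p))
              ≡⟨ f-adj (a w) (mv v A p) ⟩
            lookup A w ∎

-- Rigidity criterion: R^I(G) is rigid when the only x ∈ 𝔽₂^W supported outside I with
-- A_G x = 0 is x = 0, because the swapped pairs of any colour-preserving automorphism
-- form such an x.
rigid-criterion : ∀ {n m} (E : BiAdj n m) I →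
  (∀ x → (∀ w → x w ≡ true → w ∉ I) → (∀ v → colComb E x v ≡ false) → Null x) → Rigid E I
rigid-criterion E I kernel-trivial σ aut =
  unswapped⇒identity (kernel-trivial swapped swapped-off-I swapped-kernel)
  where open ColourPreserving E I σ aut

-- Lemma 5: take r independent rows S of A_G, a set J of at least r columns independent on
-- S, and I = W ∖ J.  Then ∣I∣ ≤ m - r, and a vector x supported outside I is supported in
-- J, so A_G x = 0 forces x = 0; by the rigidity criterion R^I(G) is rigid.
lemma5 : (n m : ℕ) (E : BiAdj n m) (r : ℕ) → HasRank E r →
           ∃ λ (I : Subset m) → ∣ I ∣ ≤ m ∸ r × Rigid E I
lemma5 n m E r ((S , S-indep , ∣S∣≡r) , _)
  with rowRank≤colRank m E S (rowsIndep⇒RowIndep E S-indep)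
... | J , ∣S∣≤∣J∣ , J-indep = ∁ J , ∣∁J∣≤m∸r , rigid-criterion E (∁ J) kernel-trivial
  where
    ∣∁J∣≤m∸r : ∣ ∁ J ∣ ≤ m ∸ r
    ∣∁J∣≤m∸r = ≤-trans (≤-reflexive (∣∁p∣≡n∸∣p∣ J)) (∸-monoʳ-≤ m (subst (_≤ ∣ J ∣) ∣S∣≡r ∣S∣≤∣J∣))
    kernel-trivial : ∀ x → (∀ w → x w ≡ true → w ∉ ∁ J) → (∀ v → colComb E x v ≡ false) → Null x
    kernel-trivial x x∉∁J Ex≡0 = J-indep x (λ w xw → x∉∁p⇒x∈p (x∉∁J w xw)) (λ v _ → Ex≡0 v)
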